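{- For $n\geq 1$, the number of permutations $\pi\in\mathcal{S}_n$ such that $\pi^2$ has exactly one descent and that descent is at position $1$ equals \[\sum_{i=1}^{\lfloor\frac{n-1}{2}\rfloor} e_{n-(2i+1)},\] where $e_j$ denotes the number of involutions in $\mathcal{S}_j$ (with $e_0=1$).
   Context: $\mathcal{S}_n$ is the symmetric group on $[n]$; a permutation $\sigma=\sigma_1\cdots\sigma_n$ (one-line notation) has a descent at position $i\in[n-1]$ if $\sigma_i>\sigma_{i+1}$. $\pi^2(i)=\pi(\pi(i))$. An involution is a permutation $\tau$ with $\tau^2$ the identity. -}

module Defs where

open import Data.Bool using (Bool; true; false; _∧_; _∨_; not; if_then_else_)
open import Data.Nat using (ℕ; zero; suc; _∸_; _*_; _+_; _/_; _<ᵇ_; _≡ᵇ_)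
open import Data.Fin using (Fin; toℕ)
open import Data.List using (List; []; _∷_; map; concatMap; filterᵇ; length; applyUpTo)
open import Data.Nat.ListAction using (sum)
open import Data.List using () renaming (allFin to allFinL)
open import Data.Vec using (Vec; []; _∷_; lookup; tabulate; toList)

allL : ∀ {A : Set} → (A → Bool) → List A → Bool
allL p []       = true
allL p (x ∷ xs) = p x ∧ allL p xs

-- A permutation of [n] in one-line notation is a vector v of length n with
-- entries in Fin n (0-indexed values), v[i] = σ(i+1) - 1, which is injective.

allVecs : (n k : ℕ) → List (Vec (Fin k) n)
allVecs zero    k = [] ∷ []
allVecs (suc n) k = concatMap (λ x → map (x ∷_) (allVecs n k)) (allFinL k)

_==F_ : ∀ {k} → Fin k → Fin k → Bool
x ==F y = toℕ x ≡ᵇ toℕ y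

isPerm : ∀ {n} → Vec (Fin n) n → Bool
isPerm {n} v =
  allL (λ i → allL (λ j → not (lookup v i ==F lookup v j) ∨ (i ==F j)) (allFinL n)) (allFinL n)

square : ∀ {n} → Vec (Fin n) n → Vec (Fin n) n
square v = tabulate (λ i → lookup v (lookup v i))

-- positions (1-based) of descents of a word, starting position counter p
descentsFrom : ∀ {k} → ℕ → List (Fin k) → List ℕ
descentsFrom p []            = []
descentsFrom p (x ∷ [])      = []
descentsFrom p (x ∷ y ∷ r)   =
  if toℕ y <ᵇ toℕ x then p ∷ descentsFrom (suc p) (y ∷ r) else descentsFrom (suc p) (y ∷ r)

descents : ∀ {n} → Vec (Fin n) n → List ℕ
descents v = descentsFrom 1 (toList v)

onlyDescentAt1 : List ℕ → Bool
onlyDescentAt1 (p ∷ []) = p ≡ᵇ 1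
onlyDescentAt1 _        = false

countSqDes1 : ℕ → ℕ
countSqDes1 n =
  length (filterᵇ (λ v → isPerm v ∧ onlyDescentAt1 (descents (square v))) (allVecs n n))

isInvolution : ∀ {n} → Vec (Fin n) n → Bool
isInvolution {n} v = allL (λ i → lookup v (lookup v i) ==F i) (allFinL n)

e : ℕ → ℕ
e j = length (filterᵇ isInvolution (allVecs j j))

rhs : ℕ → ℕ
rhs n = sum (applyUpTo (λ k → e (n ∸ (2 * suc k + 1))) ((n ∸ 1) / 2))

{-# OPTIONS --safe #-}
-- Read permutations 0-based. A permutation s of {0, …, n−1} whose only descent is at position 1 is
-- s = t 0 1 ⋯ (t−1) (t+1) ⋯ (n−1): on {0, …, t} the cycle 0 ↦ t ↦ t−1 ↦ ⋯ ↦ 1 ↦ 0, and the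
-- identity above t. If π² = s then π commutes with s, so π sends points moved by s to points
-- moved by s and preserves {0, …, t}; commuting with the cycle there forces π (j + 1) = π j + 1
-- modulo t + 1, so π is the rotation i ↦ i + a with a = π 0, and π (π 0) = t forces t = 2a.
-- Conversely, that rotation of {0, …, 2a} followed by any involution of the remaining n − 2a − 1
-- points squares to such an s. Grouping permutations by a = π 0 ≥ 1 gives Σₐ e (n − 2a − 1).
module Submission where

open import Defs
open import Data.Bool using (Bool; true; false; T; _∧_; _∨_; not)
open import Data.Bool.Properties using (T-∧)
open import Data.Empty using (⊥-elim)
open import Data.Fin using (Fin; toℕ; fromℕ<) renaming (zero to fzero; suc to fsuc)
import Data.Fin.Properties as Fin
open import Data.List using (List; []; _∷_; _++_; map; concatMap; filterᵇ; length; applyUpTo)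
import Data.List as List
open import Data.List.Properties using (map-tabulate)
open import Data.Nat using (ℕ; zero; suc; _+_; _*_; _∸_; _≤_; _<_; z≤n; s≤s; z<s; _/_; _<ᵇ_; _≡ᵇ_)
open import Data.Nat.DivMod
  using (_mod_; _%_; m%n<n; m<n⇒m%n≡m; m/n≤m; m/n*n≤m; m*n/n≡m; /-monoˡ-≤)
open import Data.Nat.ListAction using (sum)
open import Data.Nat.Properties
open import Algebra.Properties.CommutativeSemigroup +-commutativeSemigroup
  using () renaming (interchange to +-interchange)
open import Data.Product using (_×_; _,_; proj₁; proj₂)
open import Data.Vec using (Vec; []; _∷_; head; lookup; tabulate; toList)
import Data.Vec.Properties as Vec
open import Function using (_∘_; _⇔_; mk⇔; Equivalence)
open import Relation.Binary using (DecidableEquality; tri<; tri≈; tri>)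
open import Relation.Binary.PropositionalEquality
open import Relation.Nullary using (yes; no; does; ¬_)
open import Relation.Nullary.Decidable using (does-⇔; T?; _×-dec_)

-- Counting over lists

⟦_⟧ : Bool → ℕ
⟦ true ⟧  = 1
⟦ false ⟧ = 0

∑ : {A : Set} → List A → (A → ℕ) → ℕ
∑ []       f = 0
∑ (x ∷ xs) f = f x + ∑ xs f

count : {A : Set} → (A → Bool) → List A → ℕ
count p xs = ∑ xs (λ x → ⟦ p x ⟧)

module _ {A : Set} where

  length-filterᵇ : (p : A → Bool) (xs : List A) → length (filterᵇ p xs) ≡ count p xs
  length-filterᵇ p []       = refl
  length-filterᵇ p (x ∷ xs) with p x
  ... | true  = cong suc (length-filterᵇ p xs)
  ... | false = length-filterᵇ p xs

  ∑-cong : (xs : List A) {f g : A → ℕ} → (∀ x → f x ≡ g x) → ∑ xs f ≡ ∑ xs g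
  ∑-cong []       f≗g = refl
  ∑-cong (x ∷ xs) f≗g = cong₂ _+_ (f≗g x) (∑-cong xs f≗g)

  ∑-zero : (xs : List A) → ∑ xs (λ _ → 0) ≡ 0
  ∑-zero []       = refl
  ∑-zero (x ∷ xs) = ∑-zero xs

  ∑-+ : (xs : List A) (f g : A → ℕ) → ∑ xs (λ x → f x + g x) ≡ ∑ xs f + ∑ xs g
  ∑-+ []       f g = refl
  ∑-+ (x ∷ xs) f g =
    trans (cong (f x + g x +_) (∑-+ xs f g)) (+-interchange (f x) (g x) (∑ xs f) (∑ xs g))

  ∑-*ʳ : (xs : List A) (f : A → ℕ) (c : ℕ) → ∑ xs (λ x → f x * c) ≡ ∑ xs f * c
  ∑-*ʳ []       f c = refl
  ∑-*ʳ (x ∷ xs) f c = trans (cong (f x * c +_) (∑-*ʳ xs f c)) (sym (*-distribʳ-+ c (f x) _))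

  ∑-++ : (xs ys : List A) (f : A → ℕ) → ∑ (xs ++ ys) f ≡ ∑ xs f + ∑ ys f
  ∑-++ []       ys f = refl
  ∑-++ (x ∷ xs) ys f = trans (cong (f x +_) (∑-++ xs ys f)) (sym (+-assoc (f x) _ _))

  count-∧ˡ : (b : Bool) (q : A → Bool) (xs : List A) → count (λ x → b ∧ q x) xs ≡ ⟦ b ⟧ * count q xs
  count-∧ˡ true  q xs = sym (+-identityʳ _)
  count-∧ˡ false q xs = ∑-zero xs

  count-none : (p : A → Bool) (xs : List A) → (∀ x → ¬ T (p x)) → count p xs ≡ 0
  count-none p []       none = refl
  count-none p (x ∷ xs) none with p x | none x
  ... | true  | ¬⊤ = ⊥-elim (¬⊤ _)
  ... | false | _  = count-none p xs none

module _ {A B : Set} where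

  ∑-map : (g : A → B) (xs : List A) (f : B → ℕ) → ∑ (map g xs) f ≡ ∑ xs (f ∘ g)
  ∑-map g []       f = refl
  ∑-map g (x ∷ xs) f = cong (f (g x) +_) (∑-map g xs f)

  ∑-concatMap : (g : A → List B) (xs : List A) (f : B → ℕ) →
                ∑ (concatMap g xs) f ≡ ∑ xs (λ x → ∑ (g x) f)
  ∑-concatMap g []       f = refl
  ∑-concatMap g (x ∷ xs) f =
    trans (∑-++ (g x) (concatMap g xs) f) (cong (∑ (g x) f +_) (∑-concatMap g xs f))

  ∑-comm : (xs : List A) (ys : List B) (h : A → B → ℕ) →
           ∑ xs (λ x → ∑ ys (h x)) ≡ ∑ ys (λ y → ∑ xs (λ x → h x y))
  ∑-comm []       ys h = sym (∑-zero ys)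
  ∑-comm (x ∷ xs) ys h =
    trans (cong (∑ ys (h x) +_) (∑-comm xs ys h)) (sym (∑-+ ys (h x) (λ y → ∑ xs (λ x → h x y))))

record Enumerates {A : Set} (_≟_ : DecidableEquality A) (xs : List A) : Set where
  field
    once : ∀ a → count (λ b → does (a ≟ b)) xs ≡ 1

module _ {B : Set} {_≟_ : DecidableEquality B} {ys : List B} (ys-enum : Enumerates _≟_ ys) where

  count-∧-≟ : (b : Bool) (y : B) → count (λ y′ → b ∧ does (y ≟ y′)) ys ≡ ⟦ b ⟧
  count-∧-≟ b y = trans (count-∧ˡ b (λ y′ → does (y ≟ y′)) ys)
                        (trans (cong (⟦ b ⟧ *_) (Enumerates.once ys-enum y)) (*-identityʳ ⟦ b ⟧))

  count-partition : {A : Set} (key : A → B) (p : A → Bool) (xs : List A) →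
                    count p xs ≡ ∑ ys (λ y → count (λ x → p x ∧ does (key x ≟ y)) xs)
  count-partition key p xs = begin
    ∑ xs (λ x → ⟦ p x ⟧)
      ≡⟨ ∑-cong xs (λ x → sym (count-∧-≟ (p x) (key x))) ⟩
    ∑ xs (λ x → ∑ ys (λ y → ⟦ p x ∧ does (key x ≟ y) ⟧))
      ≡⟨ ∑-comm xs ys _ ⟩
    ∑ ys (λ y → ∑ xs (λ x → ⟦ p x ∧ does (key x ≟ y) ⟧))
      ∎
    where open ≡-Reasoning

record Correspondence {A B : Set} (p : A → Bool) (q : B → Bool) : Set where
  field
    to        : A → B
    from      : B → A
    to-resp   : ∀ {x} → T (p x) → T (q (to x))
    from-resp : ∀ {y} → T (q y) → T (p (from y))
    from∘to   : ∀ {x} → T (p x) → from (to x) ≡ x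
    to∘from   : ∀ {y} → T (q y) → to (from y) ≡ y

module _ {A B : Set} {_≟A_ : DecidableEquality A} {_≟B_ : DecidableEquality B} {xs : List A} {ys : List B}
         (xs-enum : Enumerates _≟A_ xs) (ys-enum : Enumerates _≟B_ ys)
         {p : A → Bool} {q : B → Bool} (corr : Correspondence p q) where

  open Correspondence corr

  private
    matched : ∀ x y → (p x ∧ does (to x ≟B y)) ≡ (q y ∧ does (from y ≟A x))
    matched x y = does-⇔ (mk⇔ forth back) (T? (p x) ×-dec (to x ≟B y)) (T? (q y) ×-dec (from y ≟A x))
      where
        forth : T (p x) × to x ≡ y → T (q y) × from y ≡ x
        forth (px , refl) = to-resp px , from∘to px
        back : T (q y) × from y ≡ x → T (p x) × to x ≡ y
        back (qy , refl) = from-resp qy , to∘from qy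

  count-correspondence : count p xs ≡ count q ys
  count-correspondence = begin
    count p xs
      ≡⟨ count-partition ys-enum to p xs ⟩
    ∑ ys (λ y → ∑ xs (λ x → ⟦ p x ∧ does (to x ≟B y) ⟧))
      ≡⟨ ∑-cong ys (λ y → ∑-cong xs (λ x → cong ⟦_⟧ (matched x y))) ⟩
    ∑ ys (λ y → ∑ xs (λ x → ⟦ q y ∧ does (from y ≟A x) ⟧))
      ≡⟨ ∑-cong ys (λ y → count-∧-≟ xs-enum (q y) (from y)) ⟩
    count q ys
      ∎
    where open ≡-Reasoning

∑-allFin-suc : ∀ n (f : Fin (suc n) → ℕ) →
               ∑ (List.allFin (suc n)) f ≡ f fzero + ∑ (List.allFin n) (f ∘ fsuc)
∑-allFin-suc n f = cong (f fzero +_) (trans (cong (λ l → ∑ l f) (sym (map-tabulate (λ i → i) fsuc)))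
                                           (∑-map fsuc (List.allFin n) f))

∑-allFin : ∀ n (g : ℕ → ℕ) → ∑ (List.allFin n) (g ∘ toℕ) ≡ sum (applyUpTo g n)
∑-allFin zero    g = refl
∑-allFin (suc n) g = trans (∑-allFin-suc n (g ∘ toℕ)) (cong (g 0 +_) (∑-allFin n (g ∘ suc)))

allFin-enumerates : ∀ n → Enumerates Fin._≟_ (List.allFin n)
allFin-enumerates n = record { once = once n }
  where
    once : ∀ n (a : Fin n) → count (λ b → does (a Fin.≟ b)) (List.allFin n) ≡ 1
    once (suc n) a = trans (∑-allFin-suc n (λ b → ⟦ does (a Fin.≟ b) ⟧)) (shifted a)
      where
        shifted : ∀ a → ⟦ does (a Fin.≟ fzero) ⟧ + count (λ b → does (a Fin.≟ fsuc b)) (List.allFin n) ≡ 1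
        shifted fzero     = cong suc (∑-zero (List.allFin n))
        shifted (fsuc a′) = once n a′

allVecs-enumerates : ∀ n k → Enumerates (Vec.≡-dec Fin._≟_) (allVecs n k)
allVecs-enumerates n k = record { once = once n }
  where
    _≟ⱽ_ : ∀ {m} → DecidableEquality (Vec (Fin k) m)
    _≟ⱽ_ = Vec.≡-dec Fin._≟_
    once : ∀ n (v : Vec (Fin k) n) → count (λ u → does (v ≟ⱽ u)) (allVecs n k) ≡ 1
    once zero    []      = refl
    once (suc n) (a ∷ w) = begin
      count (λ u → does ((a ∷ w) ≟ⱽ u)) (concatMap (λ x → map (x ∷_) (allVecs n k)) (List.allFin k))
        ≡⟨ ∑-concatMap (λ x → map (x ∷_) (allVecs n k)) (List.allFin k) _ ⟩
      ∑ (List.allFin k) (λ x → count (λ u → does ((a ∷ w) ≟ⱽ u)) (map (x ∷_) (allVecs n k)))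
        ≡⟨ ∑-cong (List.allFin k) (λ x → ∑-map (x ∷_) (allVecs n k) _) ⟩
      ∑ (List.allFin k) (λ x → count (λ u → does (a Fin.≟ x) ∧ does (w ≟ⱽ u)) (allVecs n k))
        ≡⟨ ∑-cong (List.allFin k) (λ x → count-∧ˡ (does (a Fin.≟ x)) _ (allVecs n k)) ⟩
      ∑ (List.allFin k) (λ x → ⟦ does (a Fin.≟ x) ⟧ * count (λ u → does (w ≟ⱽ u)) (allVecs n k))
        ≡⟨ ∑-cong (List.allFin k) (λ x → cong (⟦ does (a Fin.≟ x) ⟧ *_) (once n w)) ⟩
      ∑ (List.allFin k) (λ x → ⟦ does (a Fin.≟ x) ⟧ * 1)
        ≡⟨ ∑-*ʳ (List.allFin k) _ 1 ⟩
      count (λ x → does (a Fin.≟ x)) (List.allFin k) * 1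
        ≡⟨ *-identityʳ _ ⟩
      count (λ x → does (a Fin.≟ x)) (List.allFin k)
        ≡⟨ Enumerates.once (allFin-enumerates k) a ⟩
      1 ∎
      where open ≡-Reasoning

-- Positions at or beyond the length read as 0.
at : ∀ {N L} → Vec (Fin N) L → ℕ → ℕ
at []      _       = 0
at (x ∷ v) zero    = toℕ x
at (x ∷ v) (suc i) = at v i

at-lookup : ∀ {N L} (v : Vec (Fin N) L) (i : Fin L) → at v (toℕ i) ≡ toℕ (lookup v i)
at-lookup (x ∷ v) fzero    = refl
at-lookup (x ∷ v) (fsuc i) = at-lookup v i

at-< : ∀ {N L} (v : Vec (Fin N) L) {i} → i < L → at v i < N
at-< (x ∷ v) {zero}  _         = Fin.toℕ<n x
at-< (x ∷ v) {suc i} (s≤s i<L) = at-< v i<L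

at-injective : ∀ {N L} {v w : Vec (Fin N) L} → (∀ {i} → i < L → at v i ≡ at w i) → v ≡ w
at-injective {v = []}    {[]}    _   = refl
at-injective {v = x ∷ v} {y ∷ w} v≗w =
  cong₂ _∷_ (Fin.toℕ-injective (v≗w (s≤s z≤n))) (at-injective (λ i<L → v≗w (s≤s i<L)))

at-tabulate : ∀ {N L} (f : Fin L → Fin N) (i : Fin L) → at (tabulate f) (toℕ i) ≡ toℕ (f i)
at-tabulate f i = trans (at-lookup (tabulate f) i) (cong toℕ (Vec.lookup∘tabulate f i))

at-at-lookup : ∀ {n} (v : Vec (Fin n) n) (i : Fin n) → at v (at v (toℕ i)) ≡ toℕ (lookup v (lookup v i))
at-at-lookup v i = trans (cong (at v) (at-lookup v i)) (at-lookup v (lookup v i))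

∀Fin⇒∀< : ∀ {n} (P : ℕ → Set) → (∀ (i : Fin n) → P (toℕ i)) → ∀ {i} → i < n → P i
∀Fin⇒∀< P h i<n = subst P (Fin.toℕ-fromℕ< i<n) (h (fromℕ< i<n))

-- Values of h are reduced modulo L.
tabulateℕ : ∀ L → (ℕ → ℕ) → Vec (Fin L) L
tabulateℕ zero    h = []
tabulateℕ (suc L) h = tabulate (λ j → h (toℕ j) mod suc L)

at-tabulateℕ : ∀ L (h : ℕ → ℕ) {i} → i < L → h i < L → at (tabulateℕ L h) i ≡ h i
at-tabulateℕ (suc L) h = ∀Fin⇒∀< (λ i → h i < suc L → _ ≡ h i) λ j h<L → begin
  at (tabulateℕ (suc L) h) (toℕ j)  ≡⟨ at-tabulate (λ j → h (toℕ j) mod suc L) j ⟩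
  toℕ (h (toℕ j) mod suc L)        ≡⟨ Fin.toℕ-fromℕ< (m%n<n (h (toℕ j)) (suc L)) ⟩
  h (toℕ j) % suc L                ≡⟨ m<n⇒m%n≡m h<L ⟩
  h (toℕ j)                        ∎
  where open ≡-Reasoning

MapsBelow : ℕ → (ℕ → ℕ) → Set
MapsBelow n f = ∀ {i} → i < n → f i < n

InjectiveBelow : ℕ → (ℕ → ℕ) → Set
InjectiveBelow n f = ∀ {i} → i < n → ∀ {j} → j < n → f i ≡ f j → i ≡ j

InvolutiveBelow : ℕ → (ℕ → ℕ) → Set
InvolutiveBelow n f = ∀ {i} → i < n → f (f i) ≡ i

T-not-∨ : ∀ {a b} → T (not a ∨ b) ⇔ (T a → T b)
T-not-∨ {true}  = mk⇔ (λ b _ → b) (λ f → f _)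
T-not-∨ {false} = mk⇔ (λ _ ()) (λ _ → _)

T-allL-tabulate : ∀ {A : Set} {n} {p : A → Bool} (f : Fin n → A) →
                  T (allL p (List.tabulate f)) ⇔ (∀ i → T (p (f i)))
T-allL-tabulate {p = p} f = mk⇔ (forth f) (back f)
  where
    forth : ∀ {n} (f : Fin n → _) → T (allL p (List.tabulate f)) → ∀ i → T (p (f i))
    forth f h fzero    = proj₁ (Equivalence.to T-∧ h)
    forth f h (fsuc i) = forth (f ∘ fsuc) (proj₂ (Equivalence.to T-∧ h)) i
    back : ∀ {n} (f : Fin n → _) → (∀ i → T (p (f i))) → T (allL p (List.tabulate f))
    back {zero}  f h = _
    back {suc n} f h = Equivalence.from T-∧ (h fzero , back (f ∘ fsuc) (h ∘ fsuc))

isInvolution⇔involutive : ∀ {m} (τ : Vec (Fin m) m) → T (isInvolution τ) ⇔ InvolutiveBelow m (at τ)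
isInvolution⇔involutive {m} τ = mk⇔ forth back
  where
    forth : T (isInvolution τ) → InvolutiveBelow m (at τ)
    forth h = ∀Fin⇒∀< (λ i → at τ (at τ i) ≡ i) λ i →
      trans (at-at-lookup τ i) (≡ᵇ⇒≡ _ (toℕ i) (Equivalence.to (T-allL-tabulate (λ i → i)) h i))
    back : InvolutiveBelow m (at τ) → T (isInvolution τ)
    back h = Equivalence.from (T-allL-tabulate (λ i → i)) λ i →
      ≡⇒≡ᵇ _ (toℕ i) (trans (sym (at-at-lookup τ i)) (h (Fin.toℕ<n i)))

isPerm⇔injective : ∀ {n} (π : Vec (Fin n) n) → T (isPerm π) ⇔ InjectiveBelow n (at π)
isPerm⇔injective {n} π = mk⇔ forth back
  where
    forth : T (isPerm π) → InjectiveBelow n (at π)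
    forth h = ∀Fin⇒∀< (λ i → ∀ {j} → j < n → at π i ≡ at π j → i ≡ j) λ i →
              ∀Fin⇒∀< (λ j → at π (toℕ i) ≡ at π j → toℕ i ≡ j) λ j πi≡πj →
      ≡ᵇ⇒≡ (toℕ i) (toℕ j) (Equivalence.to T-not-∨
        (Equivalence.to (T-allL-tabulate (λ j → j)) (Equivalence.to (T-allL-tabulate (λ i → i)) h i) j)
        (≡⇒≡ᵇ _ _ (trans (sym (at-lookup π i)) (trans πi≡πj (at-lookup π j)))))
    back : InjectiveBelow n (at π) → T (isPerm π)
    back h = Equivalence.from (T-allL-tabulate (λ i → i)) λ i →
      Equivalence.from (T-allL-tabulate (λ j → j)) λ j → Equivalence.from T-not-∨ λ πi≡πj →
        ≡⇒≡ᵇ (toℕ i) (toℕ j) (h (Fin.toℕ<n i) (Fin.toℕ<n j)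
          (trans (at-lookup π i) (trans (≡ᵇ⇒≡ _ _ πi≡πj) (sym (at-lookup π j)))))

at-square : ∀ {n} (π : Vec (Fin n) n) → ∀ {i} → i < n → at (square π) i ≡ at π (at π i)
at-square π = ∀Fin⇒∀< (λ i → at (square π) i ≡ at π (at π i)) λ i →
  trans (at-tabulate (λ i → lookup π (lookup π i)) i) (sym (at-at-lookup π i))

Ascending : ℕ → (ℕ → ℕ) → Set
Ascending n s = ∀ {i} → suc i < n → s i ≤ s (suc i)

record OnlyDescentAt1 (n : ℕ) (s : ℕ → ℕ) : Set where
  field
    2≤n       : 2 ≤ n
    descent   : s 1 < s 0
    ascending : ∀ {i} → 2 + i < n → s (1 + i) ≤ s (2 + i)

module _ {N : ℕ} where

  descentsFrom≡[]⇒ascending : ∀ {L} p (v : Vec (Fin N) L) → descentsFrom p (toList v) ≡ [] →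
                              Ascending L (at v)
  descentsFrom≡[]⇒ascending p (x ∷ [])    _    (s≤s ())
  descentsFrom≡[]⇒ascending p (x ∷ y ∷ r) none {i} i<L with toℕ y <ᵇ toℕ x in y<ᵇx
  descentsFrom≡[]⇒ascending p (x ∷ y ∷ r) ()   _         | true
  descentsFrom≡[]⇒ascending p (x ∷ y ∷ r) none {zero}  _ | false =
    ≮⇒≥ (λ y<x → subst T y<ᵇx (<⇒<ᵇ y<x))
  descentsFrom≡[]⇒ascending p (x ∷ y ∷ r) none {suc i} (s≤s i<L) | false =
    descentsFrom≡[]⇒ascending (suc p) (y ∷ r) none i<L

  ascending⇒descentsFrom≡[] : ∀ {L} p (v : Vec (Fin N) L) → Ascending L (at v) →
                              descentsFrom p (toList v) ≡ []
  ascending⇒descentsFrom≡[] p []          _   = refl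
  ascending⇒descentsFrom≡[] p (x ∷ [])    _   = refl
  ascending⇒descentsFrom≡[] p (x ∷ y ∷ r) asc
    with toℕ y <ᵇ toℕ x in y<ᵇx | ascending⇒descentsFrom≡[] (suc p) (y ∷ r) (λ i<L → asc (s≤s i<L))
  ... | true  | _    = ⊥-elim (<⇒≱ (<ᵇ⇒< _ _ (subst T (sym y<ᵇx) _)) (asc (s≤s (s≤s z≤n))))
  ... | false | none = none

  ¬onlyDescentAt1-descentsFrom-2+ : ∀ q (l : List (Fin N)) → ¬ T (onlyDescentAt1 (descentsFrom (2 + q) l))
  ¬onlyDescentAt1-descentsFrom-2+ q []       = λ ()
  ¬onlyDescentAt1-descentsFrom-2+ q (x ∷ []) = λ ()
  ¬onlyDescentAt1-descentsFrom-2+ q (x ∷ y ∷ r)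
    with toℕ y <ᵇ toℕ x | descentsFrom (3 + q) (y ∷ r) | ¬onlyDescentAt1-descentsFrom-2+ (suc q) (y ∷ r)
  ... | true  | []    | _    = λ ()
  ... | true  | _ ∷ _ | _    = λ ()
  ... | false | _     | none = none

  onlyDescentAt1⇔ : (v : Vec (Fin N) N) → T (onlyDescentAt1 (descents v)) ⇔ OnlyDescentAt1 N (at v)
  onlyDescentAt1⇔ v = mk⇔ (forth v) (back v)
    where
      forth : ∀ {L} (v : Vec (Fin N) L) →
              T (onlyDescentAt1 (descentsFrom 1 (toList v))) → OnlyDescentAt1 L (at v)
      forth (x ∷ y ∷ r) only with toℕ y <ᵇ toℕ x in y<ᵇx | descentsFrom 2 (toList (y ∷ r)) in rest
      ... | true  | []    = record
        { 2≤n       = s≤s (s≤s z≤n)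
        ; descent   = <ᵇ⇒< _ _ (subst T (sym y<ᵇx) _)
        ; ascending = λ { (s≤s 2+i<L) → descentsFrom≡[]⇒ascending 2 (y ∷ r) rest 2+i<L }
        }
      ... | true  | _ ∷ _ = ⊥-elim only
      ... | false | _     = ⊥-elim (¬onlyDescentAt1-descentsFrom-2+ 0 (toList (y ∷ r))
                                     (subst (T ∘ onlyDescentAt1) (sym rest) only))
      back : ∀ {L} (v : Vec (Fin N) L) →
             OnlyDescentAt1 L (at v) → T (onlyDescentAt1 (descentsFrom 1 (toList v)))
      back []          d = ⊥-elim (≤⇒≯ (OnlyDescentAt1.2≤n d) (s≤s z≤n))
      back (x ∷ [])    d = ⊥-elim (≤⇒≯ (OnlyDescentAt1.2≤n d) (s≤s (s≤s z≤n)))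
      back (x ∷ y ∷ r) d with toℕ y <ᵇ toℕ x in y<ᵇx
      ... | true  = subst (λ D → T (onlyDescentAt1 (1 ∷ D)))
                          (sym (ascending⇒descentsFrom≡[] 2 (y ∷ r) (λ i<L → ascending (s≤s i<L)))) _
        where open OnlyDescentAt1 d
      ... | false = ⊥-elim (subst T y<ᵇx (<⇒<ᵇ (OnlyDescentAt1.descent d)))

-- Permutations whose only descent is at position 1

record DownCycle (n t : ℕ) (s : ℕ → ℕ) : Set where
  field
    t<n   : t < n
    wrap  : s 0 ≡ t
    shift : ∀ {j} → j < t → s (suc j) ≡ j
    fixed : ∀ {i} → t < i → i < n → s i ≡ i

module OnlyDescentAt1⇒DownCycle {n : ℕ} {s : ℕ → ℕ}
  (maps : MapsBelow n s) (injective : InjectiveBelow n s) (d : OnlyDescentAt1 n s) where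

  open OnlyDescentAt1 d

  private
    0<n : 0 < n
    0<n = <-trans z<s 2≤n

    strictly-ascending : ∀ {i} → 2 + i < n → s (1 + i) < s (2 + i)
    strictly-ascending 2+i<n = ≤∧≢⇒< (ascending 2+i<n)
      (λ eq → 1+n≢n (sym (injective (<-trans (n<1+n _) 2+i<n) 2+i<n eq)))

    lower : ∀ {j} → 1 + j < n → j ≤ s (1 + j)
    lower {zero}  _     = z≤n
    lower {suc j} 2+j<n = <-≤-trans (s≤s (lower (<-trans (n<1+n _) 2+j<n))) (strictly-ascending 2+j<n)

    upper-from-top : ∀ δ j → 2 + j + δ ≡ n → s (1 + j) ≤ 1 + j
    upper-from-top zero    j refl =
      <⇒≤pred (subst (s (1 + j) <_) (+-identityʳ (2 + j)) (maps (s≤s (s≤s (m≤m+n j 0)))))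
    upper-from-top (suc δ) j eq   = <⇒≤pred (<-≤-trans (strictly-ascending 2+j<n)
      (upper-from-top δ (suc j) (trans (cong (2 +_) (sym (+-suc j δ))) eq)))
      where
        2+j<n : 2 + j < n
        2+j<n = subst (2 + j <_) eq (m<m+n (2 + j) z<s)

    upper : ∀ {j} → 1 + j < n → s (1 + j) ≤ 1 + j
    upper {j} 1+j<n = upper-from-top (n ∸ (2 + j)) j (m+[n∸m]≡n 1+j<n)

    shift-unless-fixed : ∀ {j} → 1 + j < n → s (1 + j) ≢ 1 + j → s (1 + j) ≡ j
    shift-unless-fixed 1+j<n ≢1+j = ≤-antisym (m<1+n⇒m≤n (≤∧≢⇒< (upper 1+j<n) ≢1+j)) (lower 1+j<n)

    fixed-unless-shift : ∀ {j} → 1 + j < n → s (1 + j) ≢ j → s (1 + j) ≡ 1 + j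
    fixed-unless-shift 1+j<n ≢j = ≤-antisym (upper 1+j<n) (≤∧≢⇒< (lower 1+j<n) (≢j ∘ sym))

  t : ℕ
  t = s 0

  t<n : t < n
  t<n = maps 0<n

  1≤t : 1 ≤ t
  1≤t = <-≤-trans z<s descent

  private
    shift-below : ∀ δ {j} → suc j + δ ≡ t → s (suc j) ≡ j
    shift-below zero    {j} 1+j+0≡t =
      shift-unless-fixed 1+j<n (λ fix → 1+n≢0 (injective 1+j<n 0<n (trans fix 1+j≡t)))
      where
        1+j≡t : suc j ≡ t
        1+j≡t = trans (sym (+-identityʳ (suc j))) 1+j+0≡t
        1+j<n : suc j < n
        1+j<n = subst (_< n) (sym 1+j≡t) t<n
    shift-below (suc δ) {j} 1+j+1+δ≡t =
      shift-unless-fixed 1+j<n (λ fix → 1+n≢n (sym (injective 1+j<n 2+j<n (trans fix (sym next)))))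
      where
        2+j+δ≡t : suc (suc j) + δ ≡ t
        2+j+δ≡t = trans (sym (+-suc (suc j) δ)) 1+j+1+δ≡t
        next : s (suc (suc j)) ≡ suc j
        next = shift-below δ 2+j+δ≡t
        2+j<n : suc (suc j) < n
        2+j<n = ≤-<-trans (m≤m+n (suc (suc j)) δ) (subst (_< n) (sym 2+j+δ≡t) t<n)
        1+j<n : suc j < n
        1+j<n = <-trans (n<1+n _) 2+j<n

    fixed-above : ∀ δ → suc (t + δ) < n → s (suc (t + δ)) ≡ suc (t + δ)
    fixed-above zero    1+t<n = fixed-unless-shift 1+t<n
      (λ shifted → 1+n≢0 (injective 1+t<n 0<n (trans shifted (+-identityʳ t))))
    fixed-above (suc δ) 1+t+1+δ<n = subst (λ k → s (suc k) ≡ suc k) (sym (+-suc t δ))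
      (fixed-unless-shift 2+t+δ<n
        (λ shifted → 1+n≢n (injective 2+t+δ<n 1+t+δ<n (trans shifted (sym previous)))))
      where
        2+t+δ<n : suc (suc (t + δ)) < n
        2+t+δ<n = subst (λ k → suc k < n) (+-suc t δ) 1+t+1+δ<n
        1+t+δ<n : suc (t + δ) < n
        1+t+δ<n = <-trans (n<1+n _) 2+t+δ<n
        previous : s (suc (t + δ)) ≡ suc (t + δ)
        previous = fixed-above δ 1+t+δ<n

  downCycle : DownCycle n t s
  downCycle = record
    { t<n   = t<n
    ; wrap  = refl
    ; shift = λ {j} j<t → shift-below (t ∸ suc j) (m+[n∸m]≡n j<t)
    ; fixed = λ {i} t<i i<n → let 1+t+δ≡i = m+[n∸m]≡n t<i in
        subst (λ k → s k ≡ k) 1+t+δ≡i (fixed-above (i ∸ suc t) (subst (_< n) (sym 1+t+δ≡i) i<n))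
    }

module _ {n t : ℕ} {s : ℕ → ℕ} (c : DownCycle n t s) where

  open DownCycle c

  downCycle-lower : ∀ {j} → suc j < n → j ≤ s (suc j)
  downCycle-lower {j} 1+j<n with j <? t
  ... | yes j<t = ≤-reflexive (sym (shift j<t))
  ... | no  j≮t = ≤-trans (n≤1+n j) (≤-reflexive (sym (fixed (s≤s (≮⇒≥ j≮t)) 1+j<n)))

  downCycle-upper : ∀ {j} → suc j < n → s (suc j) ≤ suc j
  downCycle-upper {j} 1+j<n with j <? t
  ... | yes j<t = ≤-trans (≤-reflexive (shift j<t)) (n≤1+n j)
  ... | no  j≮t = ≤-reflexive (fixed (s≤s (≮⇒≥ j≮t)) 1+j<n)

  downCycle-no-fixed-point : 1 ≤ t → ∀ {i} → i ≤ t → s i ≢ i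
  downCycle-no-fixed-point 1≤t {zero}  _     s0≡0 = <⇒≢ 1≤t (sym (trans (sym wrap) s0≡0))
  downCycle-no-fixed-point 1≤t {suc j} 1+j≤t fix  = 1+n≢n (sym (trans (sym (shift 1+j≤t)) fix))

  downCycle⇒onlyDescentAt1 : 1 ≤ t → OnlyDescentAt1 n s
  downCycle⇒onlyDescentAt1 1≤t = record
    { 2≤n       = <-≤-trans (s≤s 1≤t) t<n
    ; descent   = subst₂ _<_ (sym (shift 1≤t)) (sym wrap) 1≤t
    ; ascending = λ 2+i<n → ≤-trans (downCycle-upper (<-trans (n<1+n _) 2+i<n)) (downCycle-lower 2+i<n)
    }

module _ {t : ℕ} where

  private
    unshift : ℕ → ℕ
    unshift v with <-cmp v t
    ... | tri< _ _ _ = suc v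
    ... | tri≈ _ _ _ = 0
    ... | tri> _ _ _ = v

    unshift-t : unshift t ≡ 0
    unshift-t with <-cmp t t
    ... | tri< t<t _ _ = ⊥-elim (<-irrefl refl t<t)
    ... | tri≈ _ _ _   = refl
    ... | tri> _ _ t<t = ⊥-elim (<-irrefl refl t<t)

    unshift-< : ∀ {v} → v < t → unshift v ≡ suc v
    unshift-< {v} v<t with <-cmp v t
    ... | tri< _ _ _   = refl
    ... | tri≈ _ v≡t _ = ⊥-elim (<-irrefl v≡t v<t)
    ... | tri> v≮t _ _ = ⊥-elim (v≮t v<t)

    unshift-> : ∀ {v} → t < v → unshift v ≡ v
    unshift-> {v} t<v with <-cmp v t
    ... | tri< _ _ t≮v = ⊥-elim (t≮v t<v)
    ... | tri≈ _ v≡t _ = ⊥-elim (<-irrefl (sym v≡t) t<v)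
    ... | tri> _ _ _   = refl

  downCycle-injective : ∀ {n s} → DownCycle n t s → InjectiveBelow n s
  downCycle-injective {n} {s} c i<n j<n si≡sj =
    trans (sym (unshift-s i<n)) (trans (cong unshift si≡sj) (unshift-s j<n))
    where
      open DownCycle c
      unshift-s : ∀ {i} → i < n → unshift (s i) ≡ i
      unshift-s {zero}  _ = trans (cong unshift wrap) unshift-t
      unshift-s {suc j} 1+j<n with j <? t
      ... | yes j<t = trans (cong unshift (shift j<t)) (unshift-< j<t)
      ... | no  j≮t = trans (cong unshift fix) (unshift-> (s≤s (≮⇒≥ j≮t)))
        where fix = fixed (s≤s (≮⇒≥ j≮t)) 1+j<n

-- Square roots of a down cycle

record Shape (n a : ℕ) (p : ℕ → ℕ) : Set where
  field
    1≤a             : 1 ≤ a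
    2a<n            : a + a < n
    block-low       : ∀ {i} → i ≤ a → p i ≡ a + i
    block-high      : ∀ {j} → j < a → p (suc a + j) ≡ j
    tail-maps       : ∀ {i} → a + a < i → i < n → a + a < p i
    tail-involutive : ∀ {i} → a + a < i → i < n → p (p i) ≡ i

module SquareRootOfDownCycle {n t : ℕ} {p : ℕ → ℕ}
  (maps : MapsBelow n p) (injective : InjectiveBelow n p)
  (c : DownCycle n t (λ i → p (p i))) (1≤t : 1 ≤ t) where

  open DownCycle c

  private
    s : ℕ → ℕ
    s i = p (p i)

    preserves-cycle : ∀ {i} → i ≤ t → p i ≤ t
    preserves-cycle {i} i≤t with p i ≤? t
    ... | yes pi≤t = pi≤t
    ... | no  pi≰t = ⊥-elim (downCycle-no-fixed-point c 1≤t i≤t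
                       (injective (maps (maps i<n)) i<n (fixed (≰⇒> pi≰t) (maps i<n))))
      where i<n = ≤-<-trans i≤t t<n

    -- p commutes with s = p ∘ p.
    predecessor : ∀ {j} → j < t → p j ≡ s (p (suc j))
    predecessor j<t = cong p (sym (shift j<t))

    step-inside : ∀ {j} → j < t → p j < t → p (suc j) ≡ suc (p j)
    step-inside {j} j<t pj<t with p (suc j) in eq | predecessor j<t
    ... | zero  | pj≡s0 = ⊥-elim (<-irrefl (trans pj≡s0 wrap) pj<t)
    ... | suc y | pj≡sy = cong suc (sym (trans pj≡sy (shift (subst (_≤ t) eq (preserves-cycle j<t)))))

    step-wrap : ∀ {j} → j < t → p j ≡ t → p (suc j) ≡ 0
    step-wrap {j} j<t pj≡t with p (suc j) in eq | predecessor j<t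
    ... | zero  | _     = refl
    ... | suc y | pj≡sy = ⊥-elim (<-irrefl (trans (sym (shift y<t)) (trans (sym pj≡sy) pj≡t)) y<t)
      where y<t = subst (_≤ t) eq (preserves-cycle j<t)

    ascending-run : ∀ {i₀ v₀} → p i₀ ≡ v₀ →
                    ∀ δ → i₀ + δ ≤ t → v₀ + δ ≤ t → p (i₀ + δ) ≡ v₀ + δ
    ascending-run {i₀} {v₀} pi₀≡v₀ zero _ _ =
      trans (cong p (+-identityʳ i₀)) (trans pi₀≡v₀ (sym (+-identityʳ v₀)))
    ascending-run {i₀} {v₀} pi₀≡v₀ (suc δ) i₀+1+δ≤t v₀+1+δ≤t rewrite +-suc i₀ δ | +-suc v₀ δ =
      trans (step-inside i₀+1+δ≤t (subst (_< t) (sym previous) v₀+1+δ≤t)) (cong suc previous)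
      where
        previous = ascending-run pi₀≡v₀ δ (≤-trans (n≤1+n _) i₀+1+δ≤t) (≤-trans (n≤1+n _) v₀+1+δ≤t)

  a : ℕ
  a = p 0

  private
    a≤t : a ≤ t
    a≤t = preserves-cycle z≤n

    -- By injectivity, from p (t ∸ a) = t = s 0 = p a.
    t≡a+a : t ≡ a + a
    t≡a+a = begin
      t             ≡⟨ m+[n∸m]≡n a≤t ⟨
      a + (t ∸ a)   ≡⟨ cong (a +_) (injective t∸a<n (≤-<-trans a≤t t<n) p[t∸a]≡pa) ⟩
      a + a         ∎
      where
        open ≡-Reasoning
        t∸a<n : t ∸ a < n
        t∸a<n = ≤-<-trans (m∸n≤m t a) t<n
        p[t∸a]≡pa : p (t ∸ a) ≡ p a
        p[t∸a]≡pa = trans (ascending-run refl (t ∸ a) (m∸n≤m t a) (≤-reflexive (m+[n∸m]≡n a≤t)))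
                          (trans (m+[n∸m]≡n a≤t) (sym wrap))

    1≤a : 1 ≤ a
    1≤a = n≢0⇒n>0 (λ a≡0 → <⇒≢ 1≤t (sym (trans t≡a+a (cong₂ _+_ a≡0 a≡0))))

    stays-outside : ∀ {i} → t < i → i < n → t < p i
    stays-outside {i} t<i i<n with p i ≤? t
    ... | yes pi≤t = ⊥-elim (<⇒≱ t<i (subst (_≤ t) (fixed t<i i<n) (preserves-cycle pi≤t)))
    ... | no  pi≰t = ≰⇒> pi≰t

    a+a<⇒t< : ∀ {i} → a + a < i → t < i
    a+a<⇒t< = subst (_< _) (sym t≡a+a)

  shape : Shape n a p
  shape = record
    { 1≤a             = 1≤a
    ; 2a<n            = subst (_< n) t≡a+a t<n
    ; block-low       = λ {i} i≤a →
                          ascending-run refl i (≤-trans i≤a a≤t)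
                            (subst (a + i ≤_) (sym t≡a+a) (+-monoʳ-≤ a i≤a))
    ; block-high      = λ {j} j<a → ascending-run (step-wrap a<t wrap) j
                          (subst (suc a + j ≤_) (sym t≡a+a) (+-monoʳ-< a j<a)) (≤-trans (<⇒≤ j<a) a≤t)
    ; tail-maps       = λ 2a<i i<n → subst (_< _) t≡a+a (stays-outside (a+a<⇒t< 2a<i) i<n)
    ; tail-involutive = λ 2a<i i<n → fixed (a+a<⇒t< 2a<i) i<n
    }
    where
      a<t : a < t
      a<t = subst (a <_) (sym t≡a+a) (m<m+n a 1≤a)

module _ {n a : ℕ} {p : ℕ → ℕ} (sh : Shape n a p) where

  open Shape sh

  shape⇒downCycle : DownCycle n (a + a) (λ i → p (p i))
  shape⇒downCycle = record
    { t<n   = 2a<n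
    ; wrap  = trans (cong p (trans (block-low z≤n) (+-identityʳ a))) (block-low ≤-refl)
    ; shift = shift
    ; fixed = tail-involutive
    }
    where
      shift : ∀ {j} → j < a + a → p (p (suc j)) ≡ j
      shift {j} j<2a with suc j ≤? a
      ... | yes 1+j≤a = trans (cong p (trans (block-low 1+j≤a) (+-suc a j))) (block-high 1+j≤a)
      ... | no  1+j≰a = begin
        p (p (suc j))       ≡⟨ cong (p ∘ p ∘ suc) a+r≡j ⟨
        p (p (suc a + r))   ≡⟨ cong p (block-high r<a) ⟩
        p r                 ≡⟨ block-low (<⇒≤ r<a) ⟩
        a + r               ≡⟨ a+r≡j ⟩
        j                   ∎
        where
          open ≡-Reasoning
          r = j ∸ a
          a+r≡j : a + r ≡ j
          a+r≡j = m+[n∸m]≡n (≤-pred (≰⇒> 1+j≰a))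
          r<a : r < a
          r<a = +-cancelˡ-< a r a (subst (_< a + a) (sym a+r≡j) j<2a)

  shape⇒injective : InjectiveBelow n p
  shape⇒injective i<n j<n pi≡pj = downCycle-injective shape⇒downCycle i<n j<n (cong p pi≡pj)

-- Splitting off the rotation block

-- On {0, …, 2a} this is i ↦ i + a modulo 2a + 1.
rotate : ℕ → ℕ → ℕ
rotate a i with i ≤? a
... | yes _ = a + i
... | no  _ = i ∸ suc a

rotate-low : ∀ a {i} → i ≤ a → rotate a i ≡ a + i
rotate-low a {i} i≤a with i ≤? a
... | yes _   = refl
... | no  i≰a = ⊥-elim (i≰a i≤a)

rotate-high : ∀ a j → rotate a (suc a + j) ≡ j
rotate-high a j with suc a + j ≤? a
... | yes 1+a+j≤a = ⊥-elim (<⇒≱ (s≤s (m≤m+n a j)) 1+a+j≤a)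
... | no  _       = m+n∸m≡n (suc a) j

rotate-< : ∀ a {i} → i < suc (a + a) → rotate a i < suc (a + a)
rotate-< a {i} i<k with i ≤? a
... | yes i≤a = s≤s (+-monoʳ-≤ a i≤a)
... | no  _   = ≤-<-trans (m∸n≤m i (suc a)) i<k

module Block (a : ℕ) where

  k : ℕ
  k = suc (a + a)

  rotationThen : (ℕ → ℕ) → ℕ → ℕ
  rotationThen τ i with i <? k
  ... | yes _ = rotate a i
  ... | no  _ = k + τ (i ∸ k)

  tailPart : (ℕ → ℕ) → ℕ → ℕ
  tailPart p j = p (k + j) ∸ k

  rotationThen-< : ∀ τ {i} → i < k → rotationThen τ i ≡ rotate a i
  rotationThen-< τ {i} i<k with i <? k
  ... | yes _   = refl
  ... | no  i≮k = ⊥-elim (i≮k i<k)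

  rotationThen-≥ : ∀ τ {i} → k ≤ i → rotationThen τ i ≡ k + τ (i ∸ k)
  rotationThen-≥ τ {i} k≤i with i <? k
  ... | yes i<k = ⊥-elim (<⇒≱ i<k k≤i)
  ... | no  _   = refl

  rotationThen-+ : ∀ τ j → rotationThen τ (k + j) ≡ k + τ j
  rotationThen-+ τ j = trans (rotationThen-≥ τ (m≤m+n k j)) (cong (λ i → k + τ i) (m+n∸m≡n k j))

  tailPart-rotationThen : ∀ τ j → tailPart (rotationThen τ) j ≡ τ j
  tailPart-rotationThen τ j = trans (cong (_∸ k) (rotationThen-+ τ j)) (m+n∸m≡n k (τ j))

shape-rotate : ∀ {n a p} → Shape n a p → ∀ {i} → i < suc (a + a) → p i ≡ rotate a i
shape-rotate {a = a} {p} sh {i} i<k with i ≤? a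
... | yes i≤a = Shape.block-low sh i≤a
... | no  i≰a = trans (cong p (sym 1+a+r≡i)) (Shape.block-high sh r<a)
  where
    r = i ∸ suc a
    1+a+r≡i : suc a + r ≡ i
    1+a+r≡i = m+[n∸m]≡n (≰⇒> i≰a)
    r<a : r < a
    r<a = +-cancelˡ-< (suc a) r a (subst (_< suc (a + a)) (sym 1+a+r≡i) i<k)

shape-cong : ∀ {n a p q} → MapsBelow n q → (∀ {i} → i < n → p i ≡ q i) → Shape n a p → Shape n a q
shape-cong {n} {a} {p} {q} maps p≗q sh = record
  { 1≤a             = 1≤a
  ; 2a<n            = 2a<n
  ; block-low       = λ i≤a →
      trans (sym (p≗q (≤-<-trans (≤-trans i≤a (m≤m+n a a)) 2a<n))) (block-low i≤a)
  ; block-high      = λ j<a →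
      trans (sym (p≗q (≤-<-trans (+-monoʳ-< a j<a) 2a<n))) (block-high j<a)
  ; tail-maps       = λ 2a<i i<n → subst (a + a <_) (p≗q i<n) (tail-maps 2a<i i<n)
  ; tail-involutive = λ {i} 2a<i i<n → begin
      q (q i)   ≡⟨ p≗q (maps i<n) ⟨
      p (q i)   ≡⟨ cong p (p≗q i<n) ⟨
      p (p i)   ≡⟨ tail-involutive 2a<i i<n ⟩
      i         ∎
  }
  where
    open Shape sh
    open ≡-Reasoning

∸-<-+ : ∀ {k m i} → k ≤ i → i < k + m → i ∸ k < m
∸-<-+ {k} {m} k≤i i<k+m = subst (_ <_) (m+n∸m≡n k m) (∸-monoˡ-< i<k+m k≤i)

module _ {a m : ℕ} where

  open Block a

  shape⇒tailPart-maps : ∀ {p} → MapsBelow (k + m) p → Shape (k + m) a p → MapsBelow m (tailPart p)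
  shape⇒tailPart-maps maps sh j<m =
    ∸-<-+ (Shape.tail-maps sh (m≤m+n k _) (+-monoʳ-< k j<m)) (maps (+-monoʳ-< k j<m))

  shape⇒tailPart-involutive : ∀ {p} → Shape (k + m) a p → InvolutiveBelow m (tailPart p)
  shape⇒tailPart-involutive {p} sh {j} j<m = begin
    p (k + (p (k + j) ∸ k)) ∸ k  ≡⟨ cong (λ i → p i ∸ k) (m+[n∸m]≡n (Shape.tail-maps sh k≤k+j k+j<n)) ⟩
    p (p (k + j)) ∸ k            ≡⟨ cong (_∸ k) (Shape.tail-involutive sh k≤k+j k+j<n) ⟩
    k + j ∸ k                    ≡⟨ m+n∸m≡n k j ⟩
    j                            ∎
    where
      open ≡-Reasoning
      k≤k+j = m≤m+n k j
      k+j<n = +-monoʳ-< k j<m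

  rotationThen-maps : ∀ {τ} → MapsBelow m τ → MapsBelow (k + m) (rotationThen τ)
  rotationThen-maps {τ} maps {i} i<n with i <? k
  ... | yes i<k = ≤-trans (rotate-< a i<k) (m≤m+n k m)
  ... | no  i≮k = +-monoʳ-< k (maps (∸-<-+ (≮⇒≥ i≮k) i<n))

  rotationThen-shape : ∀ {τ} → 1 ≤ a → InvolutiveBelow m τ → Shape (k + m) a (rotationThen τ)
  rotationThen-shape {τ} 1≤a involutive = record
    { 1≤a             = 1≤a
    ; 2a<n            = m≤m+n k m
    ; block-low       = λ i≤a →
        trans (rotationThen-< τ (s≤s (≤-trans i≤a (m≤m+n a a)))) (rotate-low a i≤a)
    ; block-high      = λ {j} j<a → trans (rotationThen-< τ (s≤s (+-monoʳ-< a j<a))) (rotate-high a j)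
    ; tail-maps       = λ k≤i _ → ≤-trans (m≤m+n k _) (≤-reflexive (sym (rotationThen-≥ τ k≤i)))
    ; tail-involutive = λ {i} k≤i i<n → begin
        rotationThen τ (rotationThen τ i)   ≡⟨ cong (rotationThen τ) (rotationThen-≥ τ k≤i) ⟩
        rotationThen τ (k + τ (i ∸ k))      ≡⟨ rotationThen-+ τ _ ⟩
        k + τ (τ (i ∸ k))                   ≡⟨ cong (k +_) (involutive (∸-<-+ k≤i i<n)) ⟩
        k + (i ∸ k)                         ≡⟨ m+[n∸m]≡n k≤i ⟩
        i                                   ∎
    }
    where open ≡-Reasoning

  rotationThen-cong : ∀ {τ τ′} → (∀ {j} → j < m → τ j ≡ τ′ j) → ∀ {i} → i < k + m →
                      rotationThen τ i ≡ rotationThen τ′ i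
  rotationThen-cong {τ} {τ′} τ≗τ′ {i} i<n with i <? k
  ... | yes _   = refl
  ... | no  i≮k = cong (k +_) (τ≗τ′ (∸-<-+ (≮⇒≥ i≮k) i<n))

  rotationThen-tailPart : ∀ {p} → Shape (k + m) a p → ∀ {i} → i < k + m →
                          rotationThen (tailPart p) i ≡ p i
  rotationThen-tailPart {p} sh {i} i<n with i <? k
  ... | yes i<k = sym (shape-rotate sh i<k)
  ... | no  i≮k =
    trans (cong (λ i′ → k + (p i′ ∸ k)) (m+[n∸m]≡n k≤i)) (m+[n∸m]≡n (Shape.tail-maps sh k≤i i<n))
    where k≤i = ≮⇒≥ i≮k

sqDes1 : ∀ {n} → Vec (Fin n) n → Bool
sqDes1 π = isPerm π ∧ onlyDescentAt1 (descents (square π))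

onlyDescentAt1-cong : ∀ {n f g} → (∀ {i} → i < n → f i ≡ g i) →
                      OnlyDescentAt1 n f → OnlyDescentAt1 n g
onlyDescentAt1-cong f≗g d = record
  { 2≤n       = 2≤n
  ; descent   = subst₂ _<_ (f≗g 2≤n) (f≗g (<-trans z<s 2≤n)) descent
  ; ascending = λ 2+i<n →
      subst₂ _≤_ (f≗g (<-trans (n<1+n _) 2+i<n)) (f≗g 2+i<n) (ascending 2+i<n)
  }
  where open OnlyDescentAt1 d

module _ {n : ℕ} (π : Vec (Fin n) n) where

  sqDes1⇒shape : T (sqDes1 π) → Shape n (at π 0) (at π)
  sqDes1⇒shape h = SquareRootOfDownCycle.shape (at-< π) injective downCycle 1≤t
    where
      injective : InjectiveBelow n (at π)
      injective = Equivalence.to (isPerm⇔injective π) (proj₁ (Equivalence.to T-∧ h))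
      only : OnlyDescentAt1 n (λ i → at π (at π i))
      only = onlyDescentAt1-cong (at-square π)
               (Equivalence.to (onlyDescentAt1⇔ (square π)) (proj₂ (Equivalence.to T-∧ h)))
      open OnlyDescentAt1⇒DownCycle (λ i<n → at-< π (at-< π i<n))
             (λ i<n j<n e → injective i<n j<n (injective (at-< π i<n) (at-< π j<n) e)) only

  shape⇒sqDes1 : ∀ {a} → Shape n a (at π) → T (sqDes1 π)
  shape⇒sqDes1 sh = Equivalence.from T-∧
    ( Equivalence.from (isPerm⇔injective π) (shape⇒injective sh)
    , Equivalence.from (onlyDescentAt1⇔ (square π))
        (onlyDescentAt1-cong (sym ∘ at-square π)
          (downCycle⇒onlyDescentAt1 (shape⇒downCycle sh) (≤-trans (Shape.1≤a sh) (m≤m+n _ _))))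
    )

sqDes1-with-head : ℕ → ∀ {n} → Vec (Fin n) n → Bool
sqDes1-with-head a π = sqDes1 π ∧ (at π 0 ≡ᵇ a)

sqDes1-with-head⇒shape : ∀ {n} a (π : Vec (Fin n) n) → T (sqDes1-with-head a π) → Shape n a (at π)
sqDes1-with-head⇒shape {n} a π h with Equivalence.to T-∧ h
... | sq , π0≡ᵇa = subst (λ a → Shape n a (at π)) (≡ᵇ⇒≡ _ _ π0≡ᵇa) (sqDes1⇒shape π sq)

shape⇒sqDes1-with-head : ∀ {n a} (π : Vec (Fin n) n) → Shape n a (at π) → T (sqDes1-with-head a π)
shape⇒sqDes1-with-head {a = a} π sh = Equivalence.from T-∧
  (shape⇒sqDes1 π sh , ≡⇒≡ᵇ _ _ (trans (Shape.block-low sh z≤n) (+-identityʳ a)))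

module _ (a m : ℕ) (1≤a : 1 ≤ a) where

  open Block a

  private
    n : ℕ
    n = k + m

    toInvolution : Vec (Fin n) n → Vec (Fin m) m
    toInvolution π = tabulateℕ m (tailPart (at π))

    fromInvolution : Vec (Fin m) m → Vec (Fin n) n
    fromInvolution τ = tabulateℕ n (rotationThen (at τ))

    at-toInvolution : ∀ π → Shape n a (at π) → ∀ {j} → j < m →
                      at (toInvolution π) j ≡ tailPart (at π) j
    at-toInvolution π sh j<m =
      at-tabulateℕ m (tailPart (at π)) j<m (shape⇒tailPart-maps (at-< π) sh j<m)

    at-fromInvolution : ∀ τ {i} → i < n → at (fromInvolution τ) i ≡ rotationThen (at τ) i
    at-fromInvolution τ i<n =
      at-tabulateℕ n (rotationThen (at τ)) i<n (rotationThen-maps (at-< τ) i<n)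

    toInvolution-involutive : ∀ π → Shape n a (at π) → InvolutiveBelow m (at (toInvolution π))
    toInvolution-involutive π sh {j} j<m = begin
      at τ (at τ j)                        ≡⟨ cong (at τ) (at-toInvolution π sh j<m) ⟩
      at τ (tailPart (at π) j)             ≡⟨ at-toInvolution π sh (shape⇒tailPart-maps (at-< π) sh j<m) ⟩
      tailPart (at π) (tailPart (at π) j)  ≡⟨ shape⇒tailPart-involutive sh j<m ⟩
      j                                    ∎
      where
        open ≡-Reasoning
        τ = toInvolution π

    fromInvolution-shape : ∀ τ → InvolutiveBelow m (at τ) → Shape n a (at (fromInvolution τ))
    fromInvolution-shape τ involutive =
      shape-cong (at-< (fromInvolution τ)) (sym ∘ at-fromInvolution τ)
                 (rotationThen-shape 1≤a involutive)

    correspondence : Correspondence (sqDes1-with-head a) isInvolution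
    correspondence = record
      { to        = toInvolution
      ; from      = fromInvolution
      ; to-resp   = λ {π} h → Equivalence.from (isInvolution⇔involutive (toInvolution π))
                      (toInvolution-involutive π (sqDes1-with-head⇒shape a π h))
      ; from-resp = λ {τ} h → shape⇒sqDes1-with-head (fromInvolution τ)
                      (fromInvolution-shape τ (Equivalence.to (isInvolution⇔involutive τ) h))
      ; from∘to   = λ {π} h → at-injective (from∘to π (sqDes1-with-head⇒shape a π h))
      ; to∘from   = λ {τ} h → at-injective (to∘from τ (Equivalence.to (isInvolution⇔involutive τ) h))
      }
      where
        open ≡-Reasoning
        from∘to : ∀ π → Shape n a (at π) → ∀ {i} → i < n →
                  at (fromInvolution (toInvolution π)) i ≡ at π i
        from∘to π sh {i} i<n = begin
          at (fromInvolution (toInvolution π)) i  ≡⟨ at-fromInvolution (toInvolution π) i<n ⟩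
          rotationThen (at (toInvolution π)) i    ≡⟨ rotationThen-cong (at-toInvolution π sh) i<n ⟩
          rotationThen (tailPart (at π)) i        ≡⟨ rotationThen-tailPart sh i<n ⟩
          at π i                                  ∎
        to∘from : ∀ τ → InvolutiveBelow m (at τ) → ∀ {j} → j < m →
                  at (toInvolution (fromInvolution τ)) j ≡ at τ j
        to∘from τ involutive {j} j<m = begin
          at (toInvolution (fromInvolution τ)) j
            ≡⟨ at-toInvolution (fromInvolution τ) (fromInvolution-shape τ involutive) j<m ⟩
          at (fromInvolution τ) (k + j) ∸ k
            ≡⟨ cong (_∸ k) (at-fromInvolution τ (+-monoʳ-< k j<m)) ⟩
          tailPart (rotationThen (at τ)) j
            ≡⟨ tailPart-rotationThen (at τ) j ⟩
          at τ j
            ∎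

  count-sqDes1-with-head-+ : count (sqDes1-with-head a) (allVecs n n) ≡ e m
  count-sqDes1-with-head-+ =
    trans (count-correspondence (allVecs-enumerates n n) (allVecs-enumerates m m) correspondence)
          (sym (length-filterᵇ isInvolution (allVecs m m)))

count-sqDes1-with-head : ∀ n a → 1 ≤ a → a + a < n →
                         count (sqDes1-with-head a) (allVecs n n) ≡ e (n ∸ suc (a + a))
count-sqDes1-with-head n a 1≤a 2a<n with n ∸ suc (a + a) | m+[n∸m]≡n 2a<n
... | m | refl = count-sqDes1-with-head-+ a m 1≤a

count-sqDes1-with-head-0 : ∀ n → count (sqDes1-with-head 0) (allVecs n n) ≡ 0
count-sqDes1-with-head-0 n = count-none (sqDes1-with-head 0) (allVecs n n)
  (λ π h → 1+n≰n (Shape.1≤a (sqDes1-with-head⇒shape 0 π h)))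

count-sqDes1-with-head-≥ : ∀ n a → n ≤ a + a → count (sqDes1-with-head a) (allVecs n n) ≡ 0
count-sqDes1-with-head-≥ n a n≤2a = count-none (sqDes1-with-head a) (allVecs n n)
  (λ π h → <⇒≱ (Shape.2a<n (sqDes1-with-head⇒shape a π h)) n≤2a)

count-by-head : ∀ {N L} (p : Vec (Fin N) (suc L) → Bool) (xs : List (Vec (Fin N) (suc L))) →
                count p xs ≡ sum (applyUpTo (λ a → count (λ π → p π ∧ (at π 0 ≡ᵇ a)) xs) N)
count-by-head {N} p xs = begin
  count p xs
    ≡⟨ count-partition (allFin-enumerates N) head p xs ⟩
  ∑ (List.allFin N) (λ b → count (λ π → p π ∧ does (head π Fin.≟ b)) xs)
    ≡⟨ ∑-cong (List.allFin N) (λ b → ∑-cong xs (λ π → cong (⟦_⟧ ∘ (p π ∧_)) (head-≟ π b))) ⟩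
  ∑ (List.allFin N) (λ b → count (λ π → p π ∧ (at π 0 ≡ᵇ toℕ b)) xs)
    ≡⟨ ∑-allFin N (λ a → count (λ π → p π ∧ (at π 0 ≡ᵇ a)) xs) ⟩
  sum (applyUpTo (λ a → count (λ π → p π ∧ (at π 0 ≡ᵇ a)) xs) N)
    ∎
  where
    open ≡-Reasoning
    head-≟ : ∀ π b → does (head π Fin.≟ b) ≡ (at π 0 ≡ᵇ toℕ b)
    head-≟ (x ∷ _) b = does-⇔ (mk⇔ (cong toℕ) Fin.toℕ-injective) (x Fin.≟ b) (toℕ x ≟ toℕ b)

sum-applyUpTo-zero : ∀ (f : ℕ → ℕ) M → (∀ {i} → i < M → f i ≡ 0) → sum (applyUpTo f M) ≡ 0
sum-applyUpTo-zero f zero    _   = refl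
sum-applyUpTo-zero f (suc M) f≡0 =
  cong₂ _+_ (f≡0 z<s) (sum-applyUpTo-zero (f ∘ suc) M (λ i<M → f≡0 (s≤s i<M)))

sum-applyUpTo-truncate : ∀ (f g : ℕ → ℕ) {L M} → L ≤ M → (∀ {i} → i < L → f i ≡ g i) →
                         (∀ {i} → L ≤ i → i < M → f i ≡ 0) → sum (applyUpTo f M) ≡ sum (applyUpTo g L)
sum-applyUpTo-truncate f g {zero}  {M}     _         _   f≡0 = sum-applyUpTo-zero f M (f≡0 z≤n)
sum-applyUpTo-truncate f g {suc L} {suc M} (s≤s L≤M) f≗g f≡0 =
  cong₂ _+_ (f≗g z<s) (sum-applyUpTo-truncate (f ∘ suc) (g ∘ suc) L≤M (λ i<L → f≗g (s≤s i<L))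
                                              (λ L≤i i<M → f≡0 (s≤s L≤i) (s≤s i<M)))

<-half⇔ : ∀ {i m} → i < m / 2 ⇔ suc i + suc i ≤ m
<-half⇔ {i} {m} = mk⇔
  (λ i<m/2 → subst (_≤ m) (double (suc i)) (≤-trans (*-monoˡ-≤ 2 i<m/2) (m/n*n≤m m 2)))
  (λ 2+2i≤m → subst (_≤ m / 2) (m*n/n≡m (suc i) 2)
                    (/-monoˡ-≤ 2 (subst (_≤ m) (sym (double (suc i))) 2+2i≤m)))
  where
    double : ∀ x → x * 2 ≡ x + x
    double x = trans (*-comm x 2) (cong (x +_) (+-identityʳ x))

2*n+1≡1+n+n : ∀ n → 2 * n + 1 ≡ suc (n + n)
2*n+1≡1+n+n n = trans (+-comm (2 * n) 1) (cong (λ x → suc (n + x)) (+-identityʳ n))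

theorem4p2 : (n : ℕ) → 1 ≤ n → countSqDes1 n ≡ rhs n
theorem4p2 (suc n′) _ = begin
  countSqDes1 n               ≡⟨ length-filterᵇ sqDes1 (allVecs n n) ⟩
  count sqDes1 (allVecs n n)  ≡⟨ count-by-head sqDes1 (allVecs n n) ⟩
  withHead 0 + rest           ≡⟨ cong (_+ rest) (count-sqDes1-with-head-0 n) ⟩
  rest                        ≡⟨ sum-applyUpTo-truncate _ _ (m/n≤m n′ 2) inside outside ⟩
  rhs n                       ∎
  where
    open ≡-Reasoning
    n = suc n′
    withHead : ℕ → ℕ
    withHead a = count (sqDes1-with-head a) (allVecs n n)
    rest : ℕ
    rest = sum (applyUpTo (withHead ∘ suc) n′)
    inside : ∀ {i} → i < n′ / 2 → withHead (suc i) ≡ e (n ∸ (2 * suc i + 1))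
    inside {i} i<n′/2 =
      trans (count-sqDes1-with-head n (suc i) z<s (s≤s (Equivalence.to <-half⇔ i<n′/2)))
            (cong (λ x → e (n ∸ x)) (sym (2*n+1≡1+n+n (suc i))))
    outside : ∀ {i} → n′ / 2 ≤ i → i < n′ → withHead (suc i) ≡ 0
    outside {i} n′/2≤i _ = count-sqDes1-with-head-≥ n (suc i)
      (≮⇒≥ λ 2a<n → <⇒≱ (Equivalence.from <-half⇔ (≤-pred 2a<n)) n′/2≤i)
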